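{- Let $(a_i)_{i\ge 0}$ and $(b_i)_{i\ge 0}$ be sequences of real numbers with $b_0=a_0$, and let $t(i,j)$, $0\le j\le i$, be the zero-sum triangle with these boundaries (defined in the context). For $n\ge 1$ let $T_n$ be the $n\times n$ lower triangular matrix with entries $T_n(i+1,j+1)=t(i,j)$ for $0\le j\le i\le n-1$ and $0$ above the diagonal, and write $T_n^2(p,q)$ for the $(p,q)$ entry (1-based) of $T_n^2$. Then for all $0\le i,j\le n-1$: $$T_n^2(i+1,j+1)=\begin{cases}0 & (i<j),\\ b_i^2 & (i=j),\\ s_0(i) & (i>j=0),\\ T_n^2(i,j)+t(i,j)\{b_{i-1}+b_i\}-t(i-1,j-1)\{b_{j-1}+b_j\} & (i>j>0),\end{cases}$$ where $s_0(i)=\sum_{k=0}^{i} t(i,k)a_k$.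
   Context: Zero-sum triangle: given sequences $(a_i)_{i\ge0}$, $(b_i)_{i\ge0}$ with $b_0=a_0$, define numbers $t(i,j)$ for integers $0\le j\le i$ by $t(i,0)=a_i$ for $i\ge 0$ (left boundary edge), $t(i,i)=b_i$ for $i\ge 1$ (right boundary edge), and for $0<j<i$ by the zero-sum rule $t(i,j)+t(i-1,j-1)+t(i-1,j)=0$, i.e. $t(i,j)=-t(i-1,j-1)-t(i-1,j)$. -}

module Defs where

open import Level using (Level)
open import Algebra.Bundles using (CommutativeRing)
open import Data.Nat using (ℕ; zero; suc; _<_; _≤_)
open import Data.Nat.Properties using (<-cmp)
open import Relation.Binary.Definitions using (tri<; tri≈; tri>)

module ZST {c ℓ : Level} (R : CommutativeRing c ℓ) where
  open CommutativeRing R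

  -- t a b i j : the zero-sum triangle entry t(i,j) for 0 ≤ j ≤ i;
  -- for j > i it is set to 0 (these values are the zeros above the
  -- diagonal of T_n).
  t : (ℕ → Carrier) → (ℕ → Carrier) → ℕ → ℕ → Carrier
  t a b i       zero    = a i
  t a b zero    (suc j) = 0#
  t a b (suc i) (suc j) with <-cmp j i
  ... | tri< _ _ _ = - (t a b i j + t a b i (suc j))
  ... | tri≈ _ _ _ = b (suc i)
  ... | tri> _ _ _ = 0#

  Σ< : ℕ → (ℕ → Carrier) → Carrier
  Σ< zero    f = 0#
  Σ< (suc n) f = Σ< n f + f n

  T : (ℕ → Carrier) → (ℕ → Carrier) → ℕ → ℕ → Carrier
  T a b i j = t a b i j

  -- 0-based entries of T_n^2 : (T_n^2)(i+1,j+1) = Σ_{k=0}^{n-1} T(i,k) T(k,j)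
  Tsq : (ℕ → Carrier) → (ℕ → Carrier) → ℕ → ℕ → ℕ → Carrier
  Tsq a b n i j = Σ< n (λ k → T a b i k * T a b k j)

  s0 : (ℕ → Carrier) → (ℕ → Carrier) → ℕ → Carrier
  s0 a b i = Σ< (suc i) (λ k → t a b i k * a k)

-- Extend the zero-sum rule to the whole grid, with t(i,j) = 0 above the
-- diagonal. Its defect t(i+1,k+1) + t(i,k) + t(i,k+1) then vanishes except
-- on the diagonal k = i, where it equals b_i + b_{i+1}. Writing
-- S(i,j) = Σ_k t(i,k) t(k,j) for the entries of T², expand
-- S(i+1,j+1) = Σ_k t(i+1,k+1) t(k+1,j+1) by the defect first in the row
-- index and then in the column index: every sum except S(i,j) cancels, and
-- the two diagonal defects give the two correction terms.
module Submission where

open import Defs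
open import Level using (Level)
open import Algebra.Bundles using (CommutativeRing)
open import Data.Nat using (ℕ; zero; suc; _<_; _≤_; z≤n; s≤s)
open import Data.Nat.Properties
  using ( <-cmp; <-irrefl; <-asym; <-trans; ≤-<-trans; <-≤-trans; ≰⇒>; _≤?_
        ; m≤n⇒m<n∨m≡n; n<1+n; n≤1+n)
open import Data.Product using (_×_; _,_)
open import Data.Sum using (_⊎_; inj₁; inj₂; swap)
open import Relation.Binary.Definitions using (tri<; tri≈; tri>)
open import Data.Empty using (⊥-elim)
open import Relation.Binary.PropositionalEquality as ≡ using (_≡_; _≢_)
open import Relation.Nullary using (yes; no)
import Algebra.Properties.AbelianGroup as AbelianGroupProperties
import Algebra.Properties.CommutativeSemigroup as CommutativeSemigroupProperties
import Relation.Binary.Reasoning.Setoid as SetoidReasoning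

m≢n⇒m<n∨n<m : ∀ {m n} → m ≢ n → m < n ⊎ n < m
m≢n⇒m<n∨n<m {m} {n} m≢n with <-cmp m n
... | tri< m<n _ _ = inj₁ m<n
... | tri≈ _ m≡n _ = ⊥-elim (m≢n m≡n)
... | tri> _ _ n<m = inj₂ n<m

module ZeroSumSquare {c ℓ : Level} (R : CommutativeRing c ℓ) where
  open CommutativeRing R
  open ZST R
  open AbelianGroupProperties +-abelianGroup using (//-rightDividesʳ)
  open CommutativeSemigroupProperties +-commutativeSemigroup using (interchange; x∙yz≈y∙xz)
  open SetoidReasoning setoid

  elimination : ∀ {s p x y u v} →
    s + (p + y) ≈ u → p + (x + y) ≈ v → s ≈ (x + u) + - v
  elimination {s} {p} {x} {y} {u} {v} s+p+y≈u p+x+y≈v = begin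
    s                                       ≈⟨ //-rightDividesʳ (p + (x + y)) s ⟨
    (s + (p + (x + y))) + - (p + (x + y))   ≈⟨ +-cong (sym rearrange) (-‿cong p+x+y≈v) ⟩
    (x + (s + (p + y))) + - v               ≈⟨ +-congʳ (+-congˡ s+p+y≈u) ⟩
    (x + u) + - v                           ∎
    where
    rearrange : x + (s + (p + y)) ≈ s + (p + (x + y))
    rearrange = trans (x∙yz≈y∙xz x s (p + y)) (+-congˡ (x∙yz≈y∙xz x p y))

  Σ<-cong : ∀ n {f g : ℕ → Carrier} → (∀ k → f k ≈ g k) → Σ< n f ≈ Σ< n g
  Σ<-cong zero    f≈g = refl
  Σ<-cong (suc n) f≈g = +-cong (Σ<-cong n f≈g) (f≈g n)

  Σ<-homo-+ : ∀ n (f g : ℕ → Carrier) → Σ< n (λ k → f k + g k) ≈ Σ< n f + Σ< n g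
  Σ<-homo-+ zero    f g = sym (+-identityˡ 0#)
  Σ<-homo-+ (suc n) f g = begin
    Σ< n (λ k → f k + g k) + (f n + g n)  ≈⟨ +-congʳ (Σ<-homo-+ n f g) ⟩
    (Σ< n f + Σ< n g) + (f n + g n)       ≈⟨ interchange (Σ< n f) (Σ< n g) (f n) (g n) ⟩
    (Σ< n f + f n) + (Σ< n g + g n)       ∎

  Σ<-homo-+³ : ∀ n (f g h : ℕ → Carrier) →
    Σ< n f + (Σ< n g + Σ< n h) ≈ Σ< n (λ k → f k + (g k + h k))
  Σ<-homo-+³ n f g h =
    trans (+-congˡ (sym (Σ<-homo-+ n g h))) (sym (Σ<-homo-+ n f (λ k → g k + h k)))

  Σ<-sucˡ : ∀ n (f : ℕ → Carrier) → Σ< (suc n) f ≈ f 0 + Σ< n (λ k → f (suc k))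
  Σ<-sucˡ zero    f = trans (+-identityˡ (f 0)) (sym (+-identityʳ (f 0)))
  Σ<-sucˡ (suc n) f = trans (+-congʳ (Σ<-sucˡ n f)) (+-assoc _ _ _)

  Σ<-zero : ∀ n (f : ℕ → Carrier) → (∀ k → k < n → f k ≈ 0#) → Σ< n f ≈ 0#
  Σ<-zero zero    f f≈0 = refl
  Σ<-zero (suc n) f f≈0 = trans
    (+-cong (Σ<-zero n f (λ k k<n → f≈0 k (<-trans k<n (n<1+n n)))) (f≈0 n (n<1+n n)))
    (+-identityʳ 0#)

  Σ<-truncate : ∀ {m} n (f : ℕ → Carrier) →
    m ≤ n → (∀ k → m ≤ k → f k ≈ 0#) → Σ< n f ≈ Σ< m f
  Σ<-truncate zero f z≤n f≈0 = refl
  Σ<-truncate (suc n) f m≤1+n f≈0 with m≤n⇒m<n∨m≡n m≤1+n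
  ... | inj₂ ≡.refl     = refl
  ... | inj₁ (s≤s m≤n) =
    trans (+-cong (Σ<-truncate n f m≤n f≈0) (f≈0 n m≤n)) (+-identityʳ _)

  Σ<-single : ∀ {i} n (f : ℕ → Carrier) →
    i < n → (∀ k → k ≢ i → f k ≈ 0#) → Σ< n f ≈ f i
  Σ<-single {i} n f i<n f≈0 = begin
    Σ< n f        ≈⟨ Σ<-truncate n f i<n (λ k i<k → f≈0 k (λ { ≡.refl → <-irrefl ≡.refl i<k })) ⟩
    Σ< i f + f i  ≈⟨ +-congʳ (Σ<-zero i f (λ k k<i → f≈0 k (λ { ≡.refl → <-irrefl ≡.refl k<i }))) ⟩
    0# + f i      ≈⟨ +-identityˡ (f i) ⟩
    f i           ∎

  module Triangle (a b : ℕ → Carrier) where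

    t-above : ∀ {i k} → i < k → t a b i k ≈ 0#
    t-above {zero}  {suc k} _ = refl
    t-above {suc i} {suc k} (s≤s i<k) with <-cmp k i
    ... | tri< k<i _ _ = ⊥-elim (<-asym k<i i<k)
    ... | tri≈ _ k≡i _ = ⊥-elim (<-irrefl (≡.sym k≡i) i<k)
    ... | tri> _ _ _   = refl

    t-zero-sum : ∀ {i j} → j < i → t a b (suc i) (suc j) + (t a b i j + t a b i (suc j)) ≈ 0#
    t-zero-sum {i} {j} j<i with <-cmp j i
    ... | tri< _ _ _   = -‿inverseˡ _
    ... | tri≈ _ j≡i _ = ⊥-elim (<-irrefl j≡i j<i)
    ... | tri> _ _ i<j = ⊥-elim (<-asym i<j j<i)

    t-diagonal : b 0 ≈ a 0 → ∀ i → t a b i i ≈ b i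
    t-diagonal b₀≈a₀ zero = sym b₀≈a₀
    t-diagonal b₀≈a₀ (suc i) with <-cmp i i
    ... | tri< i<i _ _ = ⊥-elim (<-irrefl ≡.refl i<i)
    ... | tri≈ _ _ _   = refl
    ... | tri> _ _ i<i = ⊥-elim (<-irrefl ≡.refl i<i)

    t-product-vanishes : ∀ {i j k} → i < k ⊎ k < j → t a b i k * t a b k j ≈ 0#
    t-product-vanishes (inj₁ i<k) = trans (*-congʳ (t-above i<k)) (zeroˡ _)
    t-product-vanishes (inj₂ k<j) = trans (*-congˡ (t-above k<j)) (zeroʳ _)

    defect : ℕ → ℕ → Carrier
    defect i k = t a b (suc i) (suc k) + (t a b i k + t a b i (suc k))

    defect-off-diagonal : ∀ {i k} → k ≢ i → defect i k ≈ 0#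
    defect-off-diagonal {i} {k} k≢i with m≢n⇒m<n∨n<m k≢i
    ... | inj₁ k<i = t-zero-sum k<i
    ... | inj₂ i<k = begin
      defect i k             ≈⟨ +-cong (t-above (s≤s i<k)) (+-cong (t-above i<k) (t-above (<-trans i<k (n<1+n k)))) ⟩
      0# + (0# + 0#)         ≈⟨ trans (+-identityˡ _) (+-identityˡ 0#) ⟩
      0#                     ∎

    defect-diagonal : b 0 ≈ a 0 → ∀ i → defect i i ≈ b i + b (suc i)
    defect-diagonal b₀≈a₀ i = begin
      defect i i               ≈⟨ +-cong (t-diagonal b₀≈a₀ (suc i)) (+-cong (t-diagonal b₀≈a₀ i) (t-above (n<1+n i))) ⟩
      b (suc i) + (b i + 0#)   ≈⟨ +-congˡ (+-identityʳ (b i)) ⟩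
      b (suc i) + b i          ≈⟨ +-comm (b (suc i)) (b i) ⟩
      b i + b (suc i)          ∎

    -- The k = 0 term drops out because t(0, q+1) = 0.
    product-sum-shift : ∀ M p q →
      Σ< (suc M) (λ k → t a b p k * t a b k (suc q))
        ≈ Σ< M (λ k → t a b p (suc k) * t a b (suc k) (suc q))
    product-sum-shift M p q =
      trans (Σ<-sucˡ M _) (trans (+-congʳ (zeroʳ (t a b p 0))) (+-identityˡ _))

    row-expansion : b 0 ≈ a 0 → ∀ {i M} (g : ℕ → Carrier) → i < M →
      Σ< M (λ k → t a b (suc i) (suc k) * g k)
        + (Σ< M (λ k → t a b i k * g k) + Σ< M (λ k → t a b i (suc k) * g k))
        ≈ (b i + b (suc i)) * g i
    row-expansion b₀≈a₀ {i} {M} g i<M = begin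
      _                              ≈⟨ Σ<-homo-+³ M _ _ _ ⟩
      Σ< M (λ k → t a b (suc i) (suc k) * g k + (t a b i k * g k + t a b i (suc k) * g k))
                                     ≈⟨ Σ<-cong M (λ k → sym (distribʳ³ (g k) _ _ _)) ⟩
      Σ< M (λ k → defect i k * g k)  ≈⟨ Σ<-single M _ i<M (λ k k≢i → trans (*-congʳ (defect-off-diagonal k≢i)) (zeroˡ _)) ⟩
      defect i i * g i               ≈⟨ *-congʳ (defect-diagonal b₀≈a₀ i) ⟩
      (b i + b (suc i)) * g i        ∎
      where
      distribʳ³ : ∀ w x y z → (x + (y + z)) * w ≈ x * w + (y * w + z * w)
      distribʳ³ w x y z = trans (distribʳ w x (y + z)) (+-congˡ (distribʳ w y z))

    column-expansion : b 0 ≈ a 0 → ∀ {j M} (g : ℕ → Carrier) → j < M →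
      Σ< M (λ k → g k * t a b (suc k) (suc j))
        + (Σ< M (λ k → g k * t a b k j) + Σ< M (λ k → g k * t a b k (suc j)))
        ≈ g j * (b j + b (suc j))
    column-expansion b₀≈a₀ {j} {M} g j<M = begin
      _                              ≈⟨ Σ<-homo-+³ M _ _ _ ⟩
      Σ< M (λ k → g k * t a b (suc k) (suc j) + (g k * t a b k j + g k * t a b k (suc j)))
                                     ≈⟨ Σ<-cong M (λ k → sym (distribˡ³ (g k) _ _ _)) ⟩
      Σ< M (λ k → g k * defect k j)  ≈⟨ Σ<-single M _ j<M (λ k k≢j → trans (*-congˡ (defect-off-diagonal (≡.≢-sym k≢j))) (zeroʳ _)) ⟩
      g j * defect j j               ≈⟨ *-congˡ (defect-diagonal b₀≈a₀ j) ⟩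
      g j * (b j + b (suc j))        ∎
      where
      distribˡ³ : ∀ w x y z → w * (x + (y + z)) ≈ w * x + (w * y + w * z)
      distribˡ³ w x y z = trans (distribˡ w x (y + z)) (+-congˡ (distribˡ w y z))

    Tsq-upper : ∀ n {i j} → i < j → Tsq a b n i j ≈ 0#
    Tsq-upper n {i} {j} i<j = Σ<-zero n _ (λ k _ → t-product-vanishes (outside k))
      where
      outside : ∀ k → i < k ⊎ k < j
      outside k with k ≤? i
      ... | yes k≤i = inj₂ (≤-<-trans k≤i i<j)
      ... | no  k≰i = inj₁ (≰⇒> k≰i)

    Tsq-diagonal : b 0 ≈ a 0 → ∀ {n i} → i < n → Tsq a b n i i ≈ b i * b i
    Tsq-diagonal b₀≈a₀ {n} {i} i<n = trans
      (Σ<-single n _ i<n (λ k k≢i → t-product-vanishes (swap (m≢n⇒m<n∨n<m k≢i))))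
      (*-cong (t-diagonal b₀≈a₀ i) (t-diagonal b₀≈a₀ i))

    Tsq-first-column : ∀ {n i} → i < n → Tsq a b n i 0 ≈ s0 a b i
    Tsq-first-column {n} i<n =
      Σ<-truncate n _ i<n (λ k i<k → t-product-vanishes {j = 0} (inj₁ i<k))

    Tsq-suc-suc : b 0 ≈ a 0 → ∀ {n i j} → suc i < n → j < i →
      Tsq a b n (suc i) (suc j)
        ≈ (Tsq a b n i j + t a b (suc i) (suc j) * (b i + b (suc i)))
          + - (t a b i j * (b j + b (suc j)))
    Tsq-suc-suc b₀≈a₀ {suc M} {i} {j} (s≤s i<M) j<i = elimination row column
      where
      P = Σ< M (λ k → t a b i k * t a b (suc k) (suc j))
      X = Tsq a b (suc M) i j
      Y = Σ< (suc M) (λ k → t a b i k * t a b k (suc j))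

      row : Tsq a b (suc M) (suc i) (suc j) + (P + Y)
              ≈ t a b (suc i) (suc j) * (b i + b (suc i))
      row = begin
        Tsq a b (suc M) (suc i) (suc j) + (P + Y)
          ≈⟨ +-cong (product-sum-shift M (suc i) j) (+-congˡ (product-sum-shift M i j)) ⟩
        _ ≈⟨ row-expansion b₀≈a₀ (λ k → t a b (suc k) (suc j)) i<M ⟩
        (b i + b (suc i)) * t a b (suc i) (suc j)
          ≈⟨ *-comm _ _ ⟩
        t a b (suc i) (suc j) * (b i + b (suc i)) ∎

      beyond-row-i : ∀ {q} k → M ≤ k → t a b i k * t a b k q ≈ 0#
      beyond-row-i {q} k M≤k = t-product-vanishes {j = q} (inj₁ (<-≤-trans i<M M≤k))

      column : P + (X + Y) ≈ t a b i j * (b j + b (suc j))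
      column = begin
        P + (X + Y)
          ≈⟨ +-congˡ (+-cong (Σ<-truncate (suc M) _ (n≤1+n M) (beyond-row-i {j}))
                             (Σ<-truncate (suc M) _ (n≤1+n M) (beyond-row-i {suc j}))) ⟩
        _ ≈⟨ column-expansion b₀≈a₀ (t a b i) (<-trans j<i i<M) ⟩
        t a b i j * (b j + b (suc j)) ∎

lemma1 : {c ℓ : Level} (R : CommutativeRing c ℓ) →
    let open CommutativeRing R in let open ZST R in
    (a b : ℕ → Carrier) → b 0 ≈ a 0 →
    (n : ℕ) → 1 ≤ n → (i j : ℕ) → i < n → j < n →
      (i < j → Tsq a b n i j ≈ 0#)
      × (i ≡ j → Tsq a b n i j ≈ b i * b i)
      × (j ≡ 0 → 0 < i → Tsq a b n i j ≈ s0 a b i)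
      × ((i' j' : ℕ) → i ≡ suc i' → j ≡ suc j' → j' < i' →
           Tsq a b n i j
             ≈ (Tsq a b n i' j' + t a b i j * (b i' + b i))
               + - (t a b i' j' * (b j' + b j)))
lemma1 R a b b₀≈a₀ n _ i j i<n _ =
    Tsq-upper n
  , (λ { ≡.refl → Tsq-diagonal b₀≈a₀ i<n })
  , (λ { ≡.refl _ → Tsq-first-column i<n })
  , (λ { _ _ ≡.refl ≡.refl j'<i' → Tsq-suc-suc b₀≈a₀ i<n j'<i' })
  where
  open ZeroSumSquare R
  open Triangle a b
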